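{- There exists a finite, simple, connected graph of order $9$ and maximum degree $8$ which has metric dimension $3$ and exactly one metric basis.
   Context: For vertices $u,v$ of a connected graph $G$, $d(u,v)$ is the distance between them. For an ordered set $W=\{w_1,\dots,w_k\}\subseteq V(G)$ and $v\in V(G)$, $r(v|W)=(d(v,w_1),\dots,d(v,w_k))$. $W$ is a resolving set if distinct vertices have distinct representations $r(\cdot|W)$. A resolving set of minimum cardinality is a metric basis; its cardinality is the metric dimension $\beta(G)$. -}

module Defs where

open import Data.Nat using (ℕ; zero; suc; _≤_)
open import Data.Bool using (Bool; true; false)
open import Data.Fin using (Fin)
open import Data.Fin.Subset using (Subset; _∈_; ∣_∣)
open import Data.Vec using (tabulate)
open import Data.Product using (Σ; ∃; _×_)
open import Relation.Binary.PropositionalEquality using (_≡_)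

record SimpleGraph (n : ℕ) : Set where
  field
    Adj   : Fin n → Fin n → Bool
    sym   : ∀ u v → Adj u v ≡ Adj v u
    irrefl : ∀ v → Adj v v ≡ false
open SimpleGraph public

module _ {n : ℕ} (G : SimpleGraph n) where

  data Walk : Fin n → Fin n → ℕ → Set where
    nil  : ∀ {v} → Walk v v zero
    cons : ∀ {u v w k} → Adj G u v ≡ true → Walk v w k → Walk u w (suc k)

  Connected : Set
  Connected = ∀ u v → ∃ λ k → Walk u v k

  Dist : Fin n → Fin n → ℕ → Set
  Dist u v k = Walk u v k × (∀ m → Walk u v m → k ≤ m)

  degree : Fin n → ℕ
  degree v = ∣ tabulate (Adj G v) ∣

  MaxDegree : ℕ → Set
  MaxDegree Δ = (∃ λ v → degree v ≡ Δ) × (∀ v → degree v ≤ Δ)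

  Resolving : Subset n → Set
  Resolving W = ∀ u v →
    (∀ w → w ∈ W → ∀ k → Dist u w k → Dist v w k) → u ≡ v

  IsMetricBasis : Subset n → Set
  IsMetricBasis W = Resolving W × (∀ W′ → Resolving W′ → ∣ W ∣ ≤ ∣ W′ ∣)

  MetricDimension : ℕ → Set
  MetricDimension k =
    (Σ (Subset n) λ W → Resolving W × ∣ W ∣ ≡ k) ×
    (∀ W → Resolving W → k ≤ ∣ W ∣)

  UniqueMetricBasis : Set
  UniqueMetricBasis =
    Σ (Subset n) λ W → IsMetricBasis W × (∀ W′ → IsMetricBasis W′ → W′ ≡ W)

-- The graph has a vertex adjacent to all others, so every distance is 0, 1 or 2 and a
-- distance is determined by equality and adjacency alone.  Resolving sets are then
-- decidable, and checking all 2⁹ subsets of the vertex set shows that every resolving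
-- set has at least three elements and that the only one with three is {2, 4, 5}.
module Submission where

open import Defs hiding (sym)
open import Data.Bool using (Bool; true; false; _∨_)
open import Data.Bool.Properties using (∨-comm) renaming (_≟_ to _≟ᵇ_)
open import Data.Fin using (Fin; toℕ; _≟_)
import Data.Fin as Fin
open import Data.Fin.Properties using (all?)
open import Data.Fin.Subset using (Subset; _∈_; ∣_∣; inside; outside)
open import Data.Fin.Subset.Properties using (_∈?_; anySubset?)
open import Data.Nat using (ℕ; suc; _≤_; _≤?_; z≤n; s≤s)
open import Data.Nat.Properties using (≤-antisym) renaming (_≟_ to _≟ℕ_)
open import Data.Product using (Σ; _×_; _,_; proj₁; proj₂)
open import Data.Vec using ([]; _∷_)
open import Data.Vec.Properties using (≡-dec)
open import Function using (_∘_; _⇔_; mk⇔; Equivalence)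
open import Relation.Binary.PropositionalEquality using (_≡_; _≢_; refl; sym; trans; subst)
open import Relation.Nullary using (Dec; yes; no; contradiction)
open import Relation.Nullary.Decidable using (from-yes; decidable-stable; ¬?; _×-dec_; _→-dec_)
open import Relation.Unary using (Decidable)

allSubset? : ∀ {n} {P : Subset n → Set} → Decidable P → Dec (∀ W → P W)
allSubset? P? with anySubset? (¬? ∘ P?)
... | yes (W , ¬PW) = no λ ∀P → ¬PW (∀P W)
... | no ∄¬P        = yes λ W → decidable-stable (P? W) (∄¬P ∘ (W ,_))

module _ {n : ℕ} (G : SimpleGraph n) where

  Walk-zero⇒≡ : ∀ {u v} → Walk G u v 0 → u ≡ v
  Walk-zero⇒≡ nil = refl

  Walk-one⇒Adj : ∀ {u v} → Walk G u v 1 → Adj G u v ≡ true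
  Walk-one⇒Adj (cons uv nil) = uv

  Dist-functional : ∀ {u v k l} → Dist G u v k → Dist G u v l → k ≡ l
  Dist-functional (walkₖ , minₖ) (walkₗ , minₗ) = ≤-antisym (minₖ _ walkₗ) (minₗ _ walkₖ)

  distance≤2 : Fin n → Fin n → ℕ
  distance≤2 u v with u ≟ v | Adj G u v
  ... | yes _ | _     = 0
  ... | no _  | true  = 1
  ... | no _  | false = 2

  module _ (hub : Fin n) (hub-adj : ∀ {v} → v ≢ hub → Adj G hub v ≡ true) where

    Adj-hub : ∀ {v} → v ≢ hub → Adj G v hub ≡ true
    Adj-hub v≢hub = trans (SimpleGraph.sym G _ hub) (hub-adj v≢hub)

    ¬Adj⇒≢hub : ∀ {u v} → u ≢ v → Adj G u v ≡ false → u ≢ hub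
    ¬Adj⇒≢hub u≢v ¬uv refl with () ← trans (sym (hub-adj (u≢v ∘ sym))) ¬uv

    walk-via-hub : ∀ {u v} → u ≢ v → Adj G u v ≡ false → Walk G u v 2
    walk-via-hub {u} {v} u≢v ¬uv =
      cons (Adj-hub (¬Adj⇒≢hub u≢v ¬uv))
        (cons (hub-adj (¬Adj⇒≢hub (u≢v ∘ sym) (trans (SimpleGraph.sym G v u) ¬uv))) nil)

    Dist-distance≤2 : ∀ u v → Dist G u v (distance≤2 u v)
    Dist-distance≤2 u v with u ≟ v | Adj G u v in uv
    ... | yes refl | _   = nil , λ _ _ → z≤n
    ... | no u≢v | true  = cons uv nil , λ where
      0 w → contradiction (Walk-zero⇒≡ w) u≢v
      (suc _) _ → s≤s z≤n
    ... | no u≢v | false = walk-via-hub u≢v uv , λ where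
      0 w → contradiction (Walk-zero⇒≡ w) u≢v
      1 w → contradiction (trans (sym (Walk-one⇒Adj w)) uv) λ ()
      (suc (suc _)) _ → s≤s (s≤s z≤n)

module _ {n : ℕ} (d : Fin n → Fin n → ℕ) where

  Resolves : Subset n → Set
  Resolves W = ∀ u v → (∀ w → w ∈ W → d u w ≡ d v w) → u ≡ v

  resolves? : Decidable Resolves
  resolves? W = all? λ u → all? λ v →
    all? (λ w → w ∈? W →-dec d u w ≟ℕ d v w) →-dec u ≟ v

  Resolves⇔Resolving : (G : SimpleGraph n) → (∀ u v → Dist G u v (d u v)) →
                       ∀ W → Resolves W ⇔ Resolving G W
  Resolves⇔Resolving G Dist-d W = mk⇔
    (λ res u v same → res u v λ w w∈W → Dist-functional G (same w w∈W _ (Dist-d u w)) (Dist-d v w))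
    (λ res u v same → res u v λ w w∈W k Dist-k → subst (Dist G v w)
      (sym (trans (Dist-functional G Dist-k (Dist-d u w)) (same w w∈W))) (Dist-d v w))

module _ {n : ℕ} (G : SimpleGraph n) where

  unique-minimum-resolving : ∀ {W} → Resolving G W →
    (∀ W′ → Resolving G W′ → ∣ W ∣ ≤ ∣ W′ ∣ × (∣ W′ ∣ ≤ ∣ W ∣ → W′ ≡ W)) →
    MetricDimension G ∣ W ∣ × UniqueMetricBasis G
  unique-minimum-resolving {W} res minimum =
    ((W , res , refl) , λ W′ → proj₁ ∘ minimum W′) ,
    (W , (res , λ W′ → proj₁ ∘ minimum W′) ,
      λ { W′ (res′ , minimal′) → proj₂ (minimum W′ res′) (minimal′ W res) })

edge : ℕ → ℕ → Bool
edge 0 1 = true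
edge 0 2 = true
edge 0 3 = true
edge 0 4 = true
edge 0 5 = true
edge 0 6 = true
edge 0 7 = true
edge 0 8 = true
edge 1 3 = true
edge 1 4 = true
edge 1 6 = true
edge 1 7 = true
edge 1 8 = true
edge 2 6 = true
edge 2 7 = true
edge 3 4 = true
edge 3 5 = true
edge 3 6 = true
edge 3 7 = true
edge 3 8 = true
edge 5 7 = true
edge 7 8 = true
edge _ _ = false

adjacent : Fin 9 → Fin 9 → Bool
adjacent u v = edge (toℕ u) (toℕ v) ∨ edge (toℕ v) (toℕ u)

graph : SimpleGraph 9
graph = record
  { Adj    = adjacent
  ; sym    = λ u v → ∨-comm (edge (toℕ u) (toℕ v)) (edge (toℕ v) (toℕ u))
  ; irrefl = from-yes (all? λ v → adjacent v v ≟ᵇ false)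
  }

hub-adjacent : ∀ {v} → v ≢ Fin.zero → adjacent Fin.zero v ≡ true
hub-adjacent {Fin.zero}  v≢0 = contradiction refl v≢0
hub-adjacent {Fin.suc v} _   = from-yes (all? λ w → adjacent Fin.zero (Fin.suc w) ≟ᵇ true) v

distance : Fin 9 → Fin 9 → ℕ
distance = distance≤2 graph

Dist-distance : ∀ u v → Dist graph u v (distance u v)
Dist-distance = Dist-distance≤2 graph Fin.zero hub-adjacent

basis : Subset 9
basis = outside ∷ outside ∷ inside ∷ outside ∷ inside ∷ inside ∷ outside ∷ outside ∷ outside ∷ []

basis-unique-minimum : ∀ W → Resolves distance W → 3 ≤ ∣ W ∣ × (∣ W ∣ ≤ 3 → W ≡ basis)
basis-unique-minimum = from-yes (allSubset? λ W →
  resolves? distance W →-dec (3 ≤? ∣ W ∣ ×-dec (∣ W ∣ ≤? 3 →-dec ≡-dec _≟ᵇ_ W basis)))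

proposition1 : Σ (SimpleGraph 9) λ G →
    Connected G × MaxDegree G 8 × MetricDimension G 3 × UniqueMetricBasis G
proposition1 = graph , connected , maxDegree , unique-minimum-resolving graph resolving-basis minimum
  where
  connected : Connected graph
  connected u v = distance u v , proj₁ (Dist-distance u v)

  maxDegree : MaxDegree graph 8
  maxDegree = (Fin.zero , refl) , from-yes (all? λ v → degree graph v ≤? 8)

  resolving⇔ : ∀ W → Resolves distance W ⇔ Resolving graph W
  resolving⇔ = Resolves⇔Resolving distance graph Dist-distance

  resolving-basis : Resolving graph basis
  resolving-basis = Equivalence.to (resolving⇔ basis) (from-yes (resolves? distance basis))

  minimum : ∀ W → Resolving graph W → 3 ≤ ∣ W ∣ × (∣ W ∣ ≤ 3 → W ≡ basis)
  minimum W = basis-unique-minimum W ∘ Equivalence.from (resolving⇔ W)
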